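{- Let $t, k$ be positive integers with $kt < n$ and $G = G_n\langle t, 2t, \ldots, kt\rangle$. Then $\chi(G) = k+1$.
   Context: For integers $1 \le t_1 < \cdots < t_k < n$, the Toeplitz graph $G_n\langle t_1, \ldots, t_k\rangle$ is the simple graph with vertex set $\{1, \ldots, n\}$ in which distinct vertices $i,j$ are adjacent iff $|i-j| \in \{t_1, \ldots, t_k\}$. $\chi(G)$ is the chromatic number. -}

module Defs where

open import Data.Nat using (ℕ; suc; _*_; _<_; ∣_-_∣)
open import Data.Fin using (Fin; toℕ)
open import Data.List using (List; applyUpTo)
open import Data.List.Membership.Propositional using (_∈_)
open import Data.Product using (Σ; _×_)
open import Relation.Binary.PropositionalEquality using (_≡_)
open import Relation.Nullary using (¬_)

-- Toeplitz graph G_n⟨T⟩ on the vertex set {1,…,n}, represented by Fin n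
-- (vertex i : Fin n stands for toℕ i + 1; differences are unaffected).
ToeplitzAdj : (n : ℕ) → List ℕ → Fin n → Fin n → Set
ToeplitzAdj n T i j = ¬ (i ≡ j) × (∣ toℕ i - toℕ j ∣ ∈ T)

multiples : (t k : ℕ) → List ℕ
multiples t k = applyUpTo (λ j → suc j * t) k

ProperColouring : {n : ℕ} → (Fin n → Fin n → Set) → (c : ℕ) → (Fin n → Fin c) → Set
ProperColouring Adj c f = ∀ i j → Adj i j → ¬ (f i ≡ f j)

Colourable : {n : ℕ} → (Fin n → Fin n → Set) → ℕ → Set
Colourable {n} Adj c = Σ (Fin n → Fin c) (ProperColouring Adj c)

ChromaticNumberIs : {n : ℕ} → (Fin n → Fin n → Set) → ℕ → Set
ChromaticNumberIs Adj m = Colourable Adj m × (∀ c → c < m → ¬ Colourable Adj c)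

{-# OPTIONS --safe #-}
module Submission where

-- Upper bound: colour vertex x by ⌊x/t⌋ mod (k+1). A jump by s·t with 0 < s ≤ k
-- raises ⌊x/t⌋ by exactly s, which changes its residue modulo k+1.
-- Lower bound: the k+1 vertices 0, t, 2t, …, kt pairwise differ by a multiple
-- jt with 1 ≤ j ≤ k, so they form a clique.

open import Defs
open import Data.Nat using (ℕ; suc; _+_; _*_; _∸_; ∣_-_∣; _<_; _≤_; s≤s; s≤s⁻¹; NonZero)
open import Data.Nat.Properties
open import Data.Nat.DivMod using (_/_; _%_; m≡m%n+[m/n]*n; m%n<n; m*n/n≡m; +-distrib-/-∣ʳ)
open import Data.Nat.Divisibility using (_∣_; n∣m*n; ∣m+n∣m⇒∣n; >⇒∤)
open import Data.Fin using (Fin; toℕ; fromℕ<)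
import Data.Fin as Fin
open import Data.Fin.Properties using (toℕ<n; toℕ-fromℕ<; fromℕ<-injective; pigeonhole)
open import Data.List.Membership.Propositional using (_∈_)
open import Data.List.Membership.Propositional.Properties using (∈-applyUpTo⁺; ∈-applyUpTo⁻)
open import Data.Product using (_,_)
open import Data.Sum using (_⊎_; inj₁; inj₂)
open import Function using (_∘_)
open import Relation.Nullary using (¬_)
open import Relation.Binary.PropositionalEquality

∣m-n∣≡d⇒n≡m+d⊎m≡n+d : ∀ {m n d} → ∣ m - n ∣ ≡ d → n ≡ m + d ⊎ m ≡ n + d
∣m-n∣≡d⇒n≡m+d⊎m≡n+d {m} {n} eq with ≤-total m n
... | inj₁ m≤n = inj₁ (trans (sym (m+[n∸m]≡n m≤n))
                             (cong (m +_) (trans (sym (m≤n⇒∣m-n∣≡n∸m m≤n)) eq)))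
... | inj₂ n≤m = inj₂ (trans (sym (m+[n∸m]≡n n≤m))
                             (cong (n +_) (trans (sym (m≤n⇒∣n-m∣≡n∸m n≤m)) eq)))

[m+n*o]/o≡m/o+n : ∀ m n o .{{_ : NonZero o}} → (m + n * o) / o ≡ m / o + n
[m+n*o]/o≡m/o+n m n o = trans (+-distrib-/-∣ʳ m (n∣m*n n)) (cong (m / o +_) (m*n/n≡m n o))

-- Equal residues would force o ∣ n, impossible for 0 < n < o.
[m+n]%o≢m%o : ∀ m {n o} .{{_ : NonZero n}} .{{_ : NonZero o}} →
              n < o → (m + n) % o ≢ m % o
[m+n]%o≢m%o m {n} {o} n<o eq = >⇒∤ n<o (∣m+n∣m⇒∣n o∣[m/o]*o+n (n∣m*n (m / o)))
  where
  open ≡-Reasoning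
  [m/o]*o+n≡[m+n]/o*o : m / o * o + n ≡ (m + n) / o * o
  [m/o]*o+n≡[m+n]/o*o = +-cancelˡ-≡ (m % o) _ _ (begin
    m % o + (m / o * o + n)       ≡⟨ sym (+-assoc (m % o) _ n) ⟩
    m % o + m / o * o + n         ≡⟨ cong (_+ n) (sym (m≡m%n+[m/n]*n m o)) ⟩
    m + n                         ≡⟨ m≡m%n+[m/n]*n (m + n) o ⟩
    (m + n) % o + (m + n) / o * o ≡⟨ cong (_+ (m + n) / o * o) eq ⟩
    m % o + (m + n) / o * o       ∎)
  o∣[m/o]*o+n : o ∣ m / o * o + n
  o∣[m/o]*o+n = subst (o ∣_) (sym [m/o]*o+n≡[m+n]/o*o) (n∣m*n ((m + n) / o))

stripe-shift-≢ : ∀ {t K s} .{{_ : NonZero t}} .{{_ : NonZero K}} .{{_ : NonZero s}} →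
                 s < K → ∀ x → (x + s * t) / t % K ≢ x / t % K
stripe-shift-≢ {t} {K} {s} s<K x eq =
  [m+n]%o≢m%o (x / t) s<K (trans (cong (_% K) (sym ([m+n*o]/o≡m/o+n x s t))) eq)

stripe-≢ : ∀ {t K s} .{{_ : NonZero t}} .{{_ : NonZero K}} .{{_ : NonZero s}} →
           s < K → ∀ x y → ∣ x - y ∣ ≡ s * t → x / t % K ≢ y / t % K
stripe-≢ s<K x y d with ∣m-n∣≡d⇒n≡m+d⊎m≡n+d {x} {y} d
... | inj₁ refl = ≢-sym (stripe-shift-≢ s<K x)
... | inj₂ refl = stripe-shift-≢ s<K y

stripeColouring : ∀ {n} t K .{{_ : NonZero t}} .{{_ : NonZero K}} → Fin n → Fin K
stripeColouring t K i = fromℕ< (m%n<n (toℕ i / t) K)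

stripeColouring-proper : ∀ n t k .{{_ : NonZero t}} →
  ProperColouring (ToeplitzAdj n (multiples t k)) (suc k) (stripeColouring t (suc k))
stripeColouring-proper n t k i j (_ , d∈T) same
  with m , m<k , d ← ∈-applyUpTo⁻ (λ j → suc j * t) d∈T
  = stripe-≢ (s≤s m<k) (toℕ i) (toℕ j) d (fromℕ<-injective _ _ _ _ same)

∈-multiples : ∀ t {d k} → 0 < d → d ≤ k → d * t ∈ multiples t k
∈-multiples t {suc m} _ m<k = ∈-applyUpTo⁺ (λ j → suc j * t) m<k

clique⇒¬Colourable : ∀ {m n} {Adj : Fin n → Fin n → Set} (g : Fin m → Fin n) →
  (∀ {a b} → a Fin.< b → Adj (g a) (g b)) → ∀ c → c < m → ¬ Colourable Adj c
clique⇒¬Colourable g clique c c<m (f , proper)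
  with a , b , a<b , fga≡fgb ← pigeonhole c<m (f ∘ g)
  = proper (g a) (g b) (clique a<b) fga≡fgb

module _ {n t k : ℕ} .{{_ : NonZero t}} (kt<n : k * t < n) where

  multipleVertex : Fin (suc k) → Fin n
  multipleVertex a = fromℕ< (≤-<-trans (*-monoˡ-≤ t (s≤s⁻¹ (toℕ<n a))) kt<n)

  toℕ-multipleVertex : ∀ a → toℕ (multipleVertex a) ≡ toℕ a * t
  toℕ-multipleVertex a = toℕ-fromℕ< _

  multipleVertex-clique : ∀ {a b} → a Fin.< b →
    ToeplitzAdj n (multiples t k) (multipleVertex a) (multipleVertex b)
  multipleVertex-clique {a} {b} a<b = distinct , subst (_∈ multiples t k) (sym distance) jump∈T
    where
    open ≡-Reasoning
    distinct : multipleVertex a ≢ multipleVertex b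
    distinct eq = <-irrefl (*-cancelʳ-≡ (toℕ a) (toℕ b) t
      (trans (sym (toℕ-multipleVertex a)) (trans (cong toℕ eq) (toℕ-multipleVertex b)))) a<b
    distance : ∣ toℕ (multipleVertex a) - toℕ (multipleVertex b) ∣ ≡ (toℕ b ∸ toℕ a) * t
    distance = begin
      ∣ toℕ (multipleVertex a) - toℕ (multipleVertex b) ∣
        ≡⟨ cong₂ ∣_-_∣ (toℕ-multipleVertex a) (toℕ-multipleVertex b) ⟩
      ∣ toℕ a * t - toℕ b * t ∣ ≡⟨ sym (*-distribʳ-∣-∣ t (toℕ a) (toℕ b)) ⟩
      ∣ toℕ a - toℕ b ∣ * t     ≡⟨ cong (_* t) (m≤n⇒∣m-n∣≡n∸m (<⇒≤ a<b)) ⟩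
      (toℕ b ∸ toℕ a) * t       ∎
    jump∈T : (toℕ b ∸ toℕ a) * t ∈ multiples t k
    jump∈T = ∈-multiples t (m<n⇒0<n∸m a<b) (≤-trans (m∸n≤m (toℕ b) (toℕ a)) (s≤s⁻¹ (toℕ<n b)))

corollary15 : (n t k : ℕ) → 1 ≤ t → 1 ≤ k → k * t < n →
    ChromaticNumberIs (ToeplitzAdj n (multiples t k)) (suc k)
corollary15 n (suc t) k _ _ kt<n =
    (stripeColouring (suc t) (suc k) , stripeColouring-proper n (suc t) k)
  , clique⇒¬Colourable (multipleVertex kt<n) (multipleVertex-clique kt<n)
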